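{- Let $n>2$ and let $f(x)=x^n+a_{n-1}x^{n-1}+\cdots+a_2x^2+a_1x\pm 1\in\mathbb{Z}[x]$ be an irreducible monogenic polynomial with constant term $\pm1$. Let $\alpha$ be a root of $f$ and $K=\mathbb{Q}(\alpha)$. Then the element \[ a_2\alpha+a_3\alpha^2+\cdots+a_{n-1}\alpha^{n-2}+\alpha^{n-1} \] is not equivalent to $\alpha$, and it also generates a power integral basis of $K$.
   Context: For a number field $K$ of degree $n$ with ring of integers $\mathbb{Z}_K$, an element $\xi\in\mathbb{Z}_K$ generates a power integral basis of $K$ if $(1,\xi,\ldots,\xi^{n-1})$ is a $\mathbb{Z}$-basis of $\mathbb{Z}_K$. An irreducible monic polynomial $f(x)\in\mathbb{Z}[x]$ is called monogenic if a root $\xi$ of $f$ generates a power integral basis of $\mathbb{Q}(\xi)$. Two elements $\alpha,\beta\in\mathbb{Z}_K$ are called equivalent if $\alpha+\beta\in\mathbb{Z}$ or $\alpha-\beta\in\mathbb{Z}$. -}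

module Defs where

open import Level using (Level; _⊔_) renaming (suc to lsuc)
open import Data.Nat using (ℕ; zero; suc; _<_; _∸_)
open import Data.Integer as ℤ using (ℤ; +_; -[1+_])
open import Data.Product using (Σ; ∃; _×_; _,_)
open import Data.Sum using (_⊎_)
open import Relation.Nullary using (¬_)
open import Relation.Binary.PropositionalEquality using (_≡_)
open import Algebra.Bundles using (CommutativeRing)

-- Integer polynomials, represented by coefficient functions ℕ → ℤ
-- (coefficient of x^i is  p i) with finite support.

sumℤ : ℕ → (ℕ → ℤ) → ℤ
sumℤ zero    g = + 0
sumℤ (suc m) g = sumℤ m g ℤ.+ g m

FinSupp : (ℕ → ℤ) → Set
FinSupp p = ∃ λ d → ∀ i → d < i → p i ≡ + 0

mulℤ[x] : (ℕ → ℤ) → (ℕ → ℤ) → ℕ → ℤ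
mulℤ[x] g h k = sumℤ (suc k) (λ i → g i ℤ.* h (k ∸ i))

-- units of ℤ[x] are the constants ±1
IsUnitℤ[x] : (ℕ → ℤ) → Set
IsUnitℤ[x] p = (p 0 ≡ + 1 ⊎ p 0 ≡ ℤ.- (+ 1)) × (∀ i → 0 < i → p i ≡ + 0)

MonicOfDegree : (ℕ → ℤ) → ℕ → Set
MonicOfDegree p n = p n ≡ + 1 × (∀ i → n < i → p i ≡ + 0)

-- irreducible element of the ring ℤ[x]: nonzero (here monic), not a unit,
-- and in every factorisation p = g*h one of g, h is a unit
Irreducibleℤ[x] : (ℕ → ℤ) → Set
Irreducibleℤ[x] p =
  ¬ IsUnitℤ[x] p ×
  (∀ g h → FinSupp g → FinSupp h → (∀ k → p k ≡ mulℤ[x] g h k) →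
     IsUnitℤ[x] g ⊎ IsUnitℤ[x] h)

module InRing {c ℓ : Level} (K : CommutativeRing c ℓ) where
  open CommutativeRing K hiding (Carrier; _≈_; 0#)
  open CommutativeRing K public using (Carrier; _≈_; 0#)

  natK : ℕ → Carrier
  natK zero    = 0#
  natK (suc m) = natK m + 1#

  intK : ℤ → Carrier
  intK (+ m)      = natK m
  intK -[1+ m ]   = - natK (suc m)

  powK : Carrier → ℕ → Carrier
  powK x zero    = 1#
  powK x (suc k) = powK x k * x

  sumK : ℕ → (ℕ → Carrier) → Carrier
  sumK zero    g = 0#
  sumK (suc m) g = sumK m g + g m

  evalK : (ℕ → ℤ) → ℕ → Carrier → Carrier
  evalK p n x = sumK (suc n) (λ i → intK (p i) * powK x i)

  IsField : Set (c ⊔ ℓ)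
  IsField = (¬ (1# ≈ 0#)) × (∀ x → ¬ (x ≈ 0#) → ∃ λ y → x * y ≈ 1#)

  CharZero : Set ℓ
  CharZero = ∀ m → ¬ (natK (suc m) ≈ 0#)

  IsSubfield : (Carrier → Set (c ⊔ ℓ)) → Set (c ⊔ ℓ)
  IsSubfield S =
    (∀ {x y} → x ≈ y → S x → S y) ×
    S 0# × S 1# ×
    (∀ {x y} → S x → S y → S (x + y)) ×
    (∀ {x} → S x → S (- x)) ×
    (∀ {x y} → S x → S y → S (x * y)) ×
    (∀ {x y} → S x → x * y ≈ 1# → S y)

  -- K = ℚ(α): the only subfield of K containing α is K itself
  -- (the prime field ℚ is contained in every subfield, as K has char 0)
  GeneratedBy : Carrier → Set (lsuc (c ⊔ ℓ))
  GeneratedBy α = ∀ (S : Carrier → Set (c ⊔ ℓ)) → IsSubfield S → S α → ∀ x → S x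

  IsAlgebraicInteger : Carrier → Set ℓ
  IsAlgebraicInteger x =
    ∃ λ (d : ℕ) → ∃ λ (q : ℕ → ℤ) →
      sumK d (λ i → intK (q i) * powK x i) + powK x d ≈ 0#

  PowerIntegralBasis : ℕ → Carrier → Set (c ⊔ ℓ)
  PowerIntegralBasis n ξ =
    (∀ i → i < n → IsAlgebraicInteger (powK ξ i)) ×
    (∀ x → IsAlgebraicInteger x →
       ∃ λ (u : ℕ → ℤ) → x ≈ sumK n (λ i → intK (u i) * powK ξ i)) ×
    (∀ (u : ℕ → ℤ) → sumK n (λ i → intK (u i) * powK ξ i) ≈ 0# →
       ∀ i → i < n → u i ≡ + 0)

  Equivalent : Carrier → Carrier → Set ℓ
  Equivalent α β =
    (∃ λ (m : ℤ) → α + β ≈ intK m) ⊎ (∃ λ (m : ℤ) → α - β ≈ intK m)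

  -- the element  a₂α + a₃α² + … + a_{n-1}α^{n-2} + α^{n-1}
  -- where f = Σ a_i X^i with a_n = 1 :  Σ_{j=0}^{n-2} a_{j+2} α^{j+1}
  theElement : (ℕ → ℤ) → ℕ → Carrier → Carrier
  theElement f n α = sumK (n ∸ 1) (λ j → intK (f (suc (suc j))) * powK α (suc j))

module Submission where

-- Write a₀ = ±1 for the constant term of f.  As f(α) = a₀ + a₁α + αβ, the element
-- y = -a₀(β + a₁) is the inverse of α and β = -a₁ - a₀y.  The powers of β are
-- unitriangular in those of y, and the powers of y are, up to the factor α^(n-1)
-- and reversal, those of α; so 1, β, …, β^(n-1) are independent and span ℤ[α].
-- Each β^i is integral because β maps the lattice ℤ[α] into itself: fraction-free
-- elimination in (β·I − M)(1, α, …, α^(n-1)) = 0 leaves a monic equation for β.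
-- Finally β ± α = m would force the relation -a₀ - (a₁ + m)α ± α² = 0, impossible
-- as 1, α, α² are independent for n > 2.

open import Defs
open import Level using (Level; _⊔_)
open import Data.Nat as ℕ using (ℕ; zero; suc; _<_; _≤_; s≤s; z≤n)
import Data.Nat.Properties as ℕ
open import Data.Integer as ℤ using (ℤ; +_; -[1+_])
import Data.Integer.Properties as ℤ
open import Data.Sign as Sign using (Sign)
open import Data.Product using (_×_; _,_; proj₂; Σ; ∃; uncurry)
open import Data.Sum using (_⊎_; inj₁; inj₂)
open import Data.Maybe using (Maybe; just; nothing)
open import Data.Empty using (⊥-elim)
open import Function using (_∘_)
open import Relation.Nullary using (yes; no; ¬_)
open import Relation.Binary.PropositionalEquality as ≡ using (_≡_; _≢_)
open import Algebra.Bundles using (CommutativeRing)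
import Algebra.Solver.Ring
open import Algebra.Solver.Ring.AlmostCommutativeRing
  using (_-Raw-AlmostCommutative⟶_; fromCommutativeRing)

IsUnitℤ : ℤ → Set
IsUnitℤ e = e ≡ + 1 ⊎ e ≡ ℤ.- (+ 1)

unit-neg : ∀ {a} → IsUnitℤ a → IsUnitℤ (ℤ.- a)
unit-neg (inj₁ ≡.refl) = inj₂ ≡.refl
unit-neg (inj₂ ≡.refl) = inj₁ ≡.refl

unit-* : ∀ {a b} → IsUnitℤ a → IsUnitℤ b → IsUnitℤ (a ℤ.* b)
unit-* (inj₁ ≡.refl) (inj₁ ≡.refl) = inj₁ ≡.refl
unit-* (inj₁ ≡.refl) (inj₂ ≡.refl) = inj₂ ≡.refl
unit-* (inj₂ ≡.refl) (inj₁ ≡.refl) = inj₂ ≡.refl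
unit-* (inj₂ ≡.refl) (inj₂ ≡.refl) = inj₁ ≡.refl

unit-^ : ∀ {a} → IsUnitℤ a → ∀ m → IsUnitℤ (a ℤ.^ m)
unit-^ a-unit zero    = inj₁ ≡.refl
unit-^ a-unit (suc m) = unit-* a-unit (unit-^ a-unit m)

unit-square : ∀ {a} → IsUnitℤ a → a ℤ.* a ≡ + 1
unit-square (inj₁ ≡.refl) = ≡.refl
unit-square (inj₂ ≡.refl) = ≡.refl

unit-≢0 : ∀ {a} → IsUnitℤ a → a ≢ + 0
unit-≢0 (inj₁ ≡.refl) ()
unit-≢0 (inj₂ ≡.refl) ()

*-unit-cancel : ∀ {a} u → IsUnitℤ a → u ℤ.* a ≡ + 0 → u ≡ + 0
*-unit-cancel u a-unit ua≡0 with ℤ.i*j≡0⇒i≡0∨j≡0 u ua≡0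
... | inj₁ u≡0 = u≡0
... | inj₂ a≡0 = ⊥-elim (unit-≢0 a-unit a≡0)

module CommutativeRingFacts {c ℓ : Level} (K : CommutativeRing c ℓ) where
  open InRing K
  open CommutativeRing K hiding (Carrier; _≈_; 0#)
  open import Algebra.Properties.Ring ring
    using (-‿involutive; -0#≈0#; -‿+-comm; -1*x≈-x; x≈y⇒x∙y⁻¹≈ε; +-inverseʳ-unique)
  open import Algebra.Properties.Semiring.Mult semiring using (×-homo-+; ×1-homo-*) renaming (_×_ to _·_)
  open import Relation.Binary.Reasoning.Setoid setoid
  import Algebra.Solver.Ring.NaturalCoefficients.Default commutativeSemiring as ℕSolver

  natK≈·1# : ∀ m → natK m ≈ m · 1#
  natK≈·1# zero    = refl
  natK≈·1# (suc m) = trans (+-congʳ (natK≈·1# m)) (+-comm _ _)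

  natK-+ : ∀ m n → natK (m ℕ.+ n) ≈ natK m + natK n
  natK-+ m n = begin
    natK (m ℕ.+ n)      ≈⟨ natK≈·1# (m ℕ.+ n) ⟩
    (m ℕ.+ n) · 1#      ≈⟨ ×-homo-+ 1# m n ⟩
    m · 1# + n · 1#     ≈⟨ sym (+-cong (natK≈·1# m) (natK≈·1# n)) ⟩
    natK m + natK n     ∎

  natK-* : ∀ m n → natK (m ℕ.* n) ≈ natK m * natK n
  natK-* m n = begin
    natK (m ℕ.* n)      ≈⟨ natK≈·1# (m ℕ.* n) ⟩
    (m ℕ.* n) · 1#      ≈⟨ ×1-homo-* m n ⟩
    m · 1# * (n · 1#)   ≈⟨ sym (*-cong (natK≈·1# m) (natK≈·1# n)) ⟩
    natK m * natK n     ∎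

  intK-1 : intK (+ 1) ≈ 1#
  intK-1 = +-identityˡ 1#

  intK-neg : ∀ a → intK (ℤ.- a) ≈ - intK a
  intK-neg (+ zero)  = sym -0#≈0#
  intK-neg (+ suc m) = refl
  intK-neg -[1+ m ]  = sym (-‿involutive _)

  intK-⊖ : ∀ m n → intK (m ℤ.⊖ n) ≈ natK m - natK n
  intK-⊖ m       zero    = sym (trans (+-congˡ -0#≈0#) (+-identityʳ _))
  intK-⊖ zero    (suc n) = sym (+-identityˡ _)
  intK-⊖ (suc m) (suc n) rewrite ℤ.[1+m]⊖[1+n]≡m⊖n m n = begin
    intK (m ℤ.⊖ n)                         ≈⟨ intK-⊖ m n ⟩
    natK m - natK n                        ≈⟨ sym (+-identityʳ _) ⟩
    (natK m - natK n) + 0#                 ≈⟨ +-congˡ (sym (-‿inverseʳ 1#)) ⟩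
    (natK m - natK n) + (1# - 1#)          ≈⟨ solve 4 (λ x y o o′ → (x :+ y) :+ (o :+ o′) := (x :+ o) :+ (y :+ o′))
                                                 refl (natK m) (- natK n) 1# (- 1#) ⟩
    (natK m + 1#) + (- natK n + - 1#)      ≈⟨ +-congˡ (-‿+-comm (natK n) 1#) ⟩
    natK (suc m) - natK (suc n)            ∎
    where open ℕSolver

  intK-+ : ∀ a b → intK (a ℤ.+ b) ≈ intK a + intK b
  intK-+ (+ m)    (+ n)    = natK-+ m n
  intK-+ (+ m)    -[1+ n ] = intK-⊖ m (suc n)
  intK-+ -[1+ m ] (+ n)    = trans (intK-⊖ n (suc m)) (+-comm _ _)
  intK-+ -[1+ m ] -[1+ n ] = begin
    - natK (suc (suc m ℕ.+ n))          ≈⟨ -‿cong (≡.subst (λ k → natK k ≈ natK (suc m) + natK (suc n))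
                                              (ℕ.+-suc (suc m) n) (natK-+ (suc m) (suc n))) ⟩
    - (natK (suc m) + natK (suc n))     ≈⟨ sym (-‿+-comm _ _) ⟩
    - natK (suc m) + - natK (suc n)     ∎

  signK : Sign → Carrier
  signK Sign.+ = 1#
  signK Sign.- = - 1#

  signK-* : ∀ s t → signK (s Sign.* t) ≈ signK s * signK t
  signK-* Sign.+ t      = sym (*-identityˡ _)
  signK-* Sign.- Sign.+ = sym (*-identityʳ _)
  signK-* Sign.- Sign.- = sym (trans (-1*x≈-x (- 1#)) (-‿involutive 1#))

  intK-◃ : ∀ s n → intK (s ℤ.◃ n) ≈ signK s * natK n
  intK-◃ Sign.+ n rewrite ℤ.+◃n≡+n n = sym (*-identityˡ _)
  intK-◃ Sign.- n rewrite ℤ.-◃n≡-n n = trans (intK-neg (+ n)) (sym (-1*x≈-x (natK n)))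

  intK-signAbs : ∀ a → intK a ≈ signK (ℤ.sign a) * natK ℤ.∣ a ∣
  intK-signAbs (+ n)    = sym (*-identityˡ _)
  intK-signAbs -[1+ n ] = sym (-1*x≈-x _)

  intK-* : ∀ a b → intK (a ℤ.* b) ≈ intK a * intK b
  intK-* a b = begin
    intK (a ℤ.* b)                 ≈⟨ intK-◃ (s Sign.* t) (∣a∣ ℕ.* ∣b∣) ⟩
    signK (s Sign.* t) * natK (∣a∣ ℕ.* ∣b∣) ≈⟨ *-cong (signK-* s t) (natK-* ∣a∣ ∣b∣) ⟩
    (signK s * signK t) * (natK ∣a∣ * natK ∣b∣)
      ≈⟨ solve 4 (λ x y u v → (x :* y) :* (u :* v) := (x :* u) :* (y :* v)) refl _ _ _ _ ⟩
    (signK s * natK ∣a∣) * (signK t * natK ∣b∣) ≈⟨ sym (*-cong (intK-signAbs a) (intK-signAbs b)) ⟩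
    intK a * intK b                ∎
    where
    open ℕSolver
    s = ℤ.sign a
    t = ℤ.sign b
    ∣a∣ = ℤ.∣ a ∣
    ∣b∣ = ℤ.∣ b ∣

  -- Agrees with intK, but sends 0 and 1 to 0# and 1# definitionally, so that the
  -- constants of the solver below read as 0# and 1#.
  ⟦_⟧ℤ : ℤ → Carrier
  ⟦ + zero     ⟧ℤ = 0#
  ⟦ + suc zero ⟧ℤ = 1#
  ⟦ a          ⟧ℤ = intK a

  ⟦⟧ℤ≈intK : ∀ a → ⟦ a ⟧ℤ ≈ intK a
  ⟦⟧ℤ≈intK (+ zero)          = refl
  ⟦⟧ℤ≈intK (+ suc zero)      = sym intK-1
  ⟦⟧ℤ≈intK (+ suc (suc n))   = refl
  ⟦⟧ℤ≈intK -[1+ n ]          = refl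

  ℤ⟶K : ℤ.+-*-rawRing -Raw-AlmostCommutative⟶ fromCommutativeRing K
  ℤ⟶K = record
    { ⟦_⟧    = ⟦_⟧ℤ
    ; +-homo = λ a b → trans (⟦⟧ℤ≈intK (a ℤ.+ b))
                 (trans (intK-+ a b) (sym (+-cong (⟦⟧ℤ≈intK a) (⟦⟧ℤ≈intK b))))
    ; *-homo = λ a b → trans (⟦⟧ℤ≈intK (a ℤ.* b))
                 (trans (intK-* a b) (sym (*-cong (⟦⟧ℤ≈intK a) (⟦⟧ℤ≈intK b))))
    ; -‿homo = λ a → trans (⟦⟧ℤ≈intK (ℤ.- a)) (trans (intK-neg a) (-‿cong (sym (⟦⟧ℤ≈intK a))))
    ; 0-homo = refl
    ; 1-homo = refl
    }

  ℤ-coefficients-decidable : ∀ a b → Maybe (⟦ a ⟧ℤ ≈ ⟦ b ⟧ℤ)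
  ℤ-coefficients-decidable a b with a ℤ.≟ b
  ... | yes ≡.refl = just refl
  ... | no _       = nothing

  module ℤSolver = Algebra.Solver.Ring ℤ.+-*-rawRing (fromCommutativeRing K) ℤ⟶K ℤ-coefficients-decidable
  open ℤSolver using (_:+_; _:*_; :-_; _:-_; con; _:=_; solve)

  sumK-cong : ∀ m {f g : ℕ → Carrier} → (∀ i → i < m → f i ≈ g i) → sumK m f ≈ sumK m g
  sumK-cong zero    f≈g = refl
  sumK-cong (suc m) f≈g = +-cong (sumK-cong m (λ i i<m → f≈g i (ℕ.m<n⇒m<1+n i<m))) (f≈g m ℕ.≤-refl)

  sumK-+ : ∀ m (f g : ℕ → Carrier) → sumK m (λ i → f i + g i) ≈ sumK m f + sumK m g
  sumK-+ zero    f g = sym (+-identityˡ 0#)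
  sumK-+ (suc m) f g = trans (+-congʳ (sumK-+ m f g))
    (solve 4 (λ a b c d → (a :+ b) :+ (c :+ d) := (a :+ c) :+ (b :+ d)) refl _ _ _ _)

  sumK-*ˡ : ∀ m a (f : ℕ → Carrier) → sumK m (λ i → a * f i) ≈ a * sumK m f
  sumK-*ˡ zero    a f = sym (zeroʳ a)
  sumK-*ˡ (suc m) a f = trans (+-congʳ (sumK-*ˡ m a f)) (sym (distribˡ a _ _))

  sumK-*ʳ : ∀ m a (f : ℕ → Carrier) → sumK m (λ i → f i * a) ≈ sumK m f * a
  sumK-*ʳ m a f = trans (sumK-cong m (λ i _ → *-comm (f i) a)) (trans (sumK-*ˡ m a f) (*-comm a _))

  sumK-neg : ∀ m (f : ℕ → Carrier) → sumK m (λ i → - f i) ≈ - sumK m f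
  sumK-neg zero    f = sym -0#≈0#
  sumK-neg (suc m) f = trans (+-congʳ (sumK-neg m f)) (-‿+-comm _ _)

  sumK-zero : ∀ m {f : ℕ → Carrier} → (∀ i → i < m → f i ≈ 0#) → sumK m f ≈ 0#
  sumK-zero zero    f≈0 = refl
  sumK-zero (suc m) f≈0 =
    trans (+-cong (sumK-zero m (λ i i<m → f≈0 i (ℕ.m<n⇒m<1+n i<m))) (f≈0 m ℕ.≤-refl)) (+-identityʳ 0#)

  sumK-head : ∀ m (f : ℕ → Carrier) → sumK (suc m) f ≈ f 0 + sumK m (λ i → f (suc i))
  sumK-head zero    f = trans (+-identityˡ _) (sym (+-identityʳ _))
  sumK-head (suc m) f = trans (+-congʳ (sumK-head m f)) (+-assoc _ _ _)

  sumK-vanishing-tail : ∀ {m n} (f : ℕ → Carrier) → m ≤ n → (∀ i → m ≤ i → f i ≈ 0#) → sumK n f ≈ sumK m f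
  sumK-vanishing-tail {m} {n} f m≤n f≈0 =
    ≡.subst (λ k → sumK k f ≈ sumK m f) (ℕ.m∸n+n≡m m≤n) (extend (n ℕ.∸ m))
    where
    extend : ∀ k → sumK (k ℕ.+ m) f ≈ sumK m f
    extend zero    = refl
    extend (suc k) = trans (+-cong (extend k) (f≈0 (k ℕ.+ m) (ℕ.m≤n+m m k))) (+-identityʳ _)

  sumK-single : ∀ m j (f : ℕ → Carrier) → j < m → (∀ i → i < m → i ≢ j → f i ≈ 0#) → sumK m f ≈ f j
  sumK-single (suc m) j f j<1+m others≈0 with j ℕ.≟ m
  ... | yes ≡.refl =
    trans (+-congʳ (sumK-zero m (λ i i<m → others≈0 i (ℕ.m<n⇒m<1+n i<m) (ℕ.<⇒≢ i<m)))) (+-identityˡ _)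
  ... | no j≢m = trans (+-congˡ (others≈0 m ℕ.≤-refl (j≢m ∘ ≡.sym))) (trans (+-identityʳ _)
      (sumK-single m j f (ℕ.≤∧≢⇒< (ℕ.≤-pred j<1+m) j≢m) (λ i i<m → others≈0 i (ℕ.m<n⇒m<1+n i<m))))

  sumK-reverse : ∀ m (f : ℕ → Carrier) → sumK m f ≈ sumK m (λ i → f (m ℕ.∸ suc i))
  sumK-reverse zero    f = refl
  sumK-reverse (suc m) f =
    sym (trans (sumK-head m _) (trans (+-congˡ (sym (sumK-reverse m f))) (+-comm _ _)))

  lincomb : ℕ → (ℕ → ℤ) → (ℕ → Carrier) → Carrier
  lincomb n u v = sumK n (λ i → intK (u i) * v i)

  record Span (v : ℕ → Carrier) (n : ℕ) (e : Carrier) : Set (c ⊔ ℓ) where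
    constructor span
    field
      coeff     : ℕ → ℤ
      expansion : e ≈ lincomb n coeff v

  Independent : (ℕ → Carrier) → ℕ → Set ℓ
  Independent v n = ∀ u → lincomb n u v ≈ 0# → ∀ i → i < n → u i ≡ + 0

  lincomb-cong : ∀ n {u u′ : ℕ → ℤ} (v : ℕ → Carrier) → (∀ i → i < n → u i ≡ u′ i) →
    lincomb n u v ≈ lincomb n u′ v
  lincomb-cong n v u≡u′ = sumK-cong n (λ i i<n → *-congʳ (reflexive (≡.cong intK (u≡u′ i i<n))))

  pad : ℕ → (ℕ → ℤ) → ℤ → ℕ → ℤ
  pad m u d i with i ℕ.<? m
  ... | yes _ = u i
  ... | no  _ = d

  pad-< : ∀ {m i} u d → i < m → pad m u d i ≡ u i
  pad-< {m} {i} u d i<m with i ℕ.<? m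
  ... | yes _   = ≡.refl
  ... | no  i≮m = ⊥-elim (i≮m i<m)

  pad-≥ : ∀ {m i} u d → m ≤ i → pad m u d i ≡ d
  pad-≥ {m} {i} u d m≤i with i ℕ.<? m
  ... | yes i<m = ⊥-elim (ℕ.<⇒≱ i<m m≤i)
  ... | no  _   = ≡.refl

  lincomb-pad-0 : ∀ {m n} u (v : ℕ → Carrier) → m ≤ n → lincomb n (pad m u (+ 0)) v ≈ lincomb m u v
  lincomb-pad-0 {m} u v m≤n =
    trans (sumK-vanishing-tail _ m≤n (λ i m≤i → trans (*-congʳ (reflexive (≡.cong intK (pad-≥ u (+ 0) m≤i)))) (zeroˡ _)))
          (lincomb-cong m v (λ i i<m → pad-< u (+ 0) i<m))

  lincomb-pad-last : ∀ m u t (v : ℕ → Carrier) → lincomb (suc m) (pad m u t) v ≈ lincomb m u v + intK t * v m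
  lincomb-pad-last m u t v =
    +-cong (lincomb-cong m v (λ i i<m → pad-< u t i<m)) (*-congʳ (reflexive (≡.cong intK (pad-≥ {m} u t ℕ.≤-refl))))

  independent-prefix : ∀ {v m n} → Independent v n → m ≤ n → Independent v m
  independent-prefix {v} {m} indep m≤n u u·v≈0 i i<m =
    ≡.trans (≡.sym (pad-< u (+ 0) i<m))
      (indep (pad m u (+ 0)) (trans (lincomb-pad-0 u v m≤n) u·v≈0) i (ℕ.<-≤-trans i<m m≤n))

  δ : ℕ → ℕ → ℤ
  δ j i with i ℕ.≟ j
  ... | yes _ = + 1
  ... | no  _ = + 0

  intK-δ-same : ∀ j → intK (δ j j) ≈ 1#
  intK-δ-same j with j ℕ.≟ j
  ... | yes _   = intK-1
  ... | no  j≢j = ⊥-elim (j≢j ≡.refl)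

  intK-δ-other : ∀ {i j} → i ≢ j → intK (δ j i) ≈ 0#
  intK-δ-other {i} {j} i≢j with i ℕ.≟ j
  ... | yes i≡j = ⊥-elim (i≢j i≡j)
  ... | no  _   = refl

  module _ {v : ℕ → Carrier} {n : ℕ} where

    span-resp : ∀ {e e′} → e ≈ e′ → Span v n e → Span v n e′
    span-resp e≈e′ (span u e≈) = span u (trans (sym e≈e′) e≈)

    span-0 : Span v n 0#
    span-0 = span (λ _ → + 0) (sym (sumK-zero n (λ i _ → zeroˡ (v i))))

    span-+ : ∀ {e e′} → Span v n e → Span v n e′ → Span v n (e + e′)
    span-+ (span u e≈) (span u′ e′≈) = span (λ i → u i ℤ.+ u′ i) (begin
      _ + _                                       ≈⟨ +-cong e≈ e′≈ ⟩
      lincomb n u v + lincomb n u′ v              ≈⟨ sym (sumK-+ n _ _) ⟩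
      sumK n (λ i → intK (u i) * v i + intK (u′ i) * v i)
        ≈⟨ sumK-cong n (λ i _ → sym (trans (*-congʳ (intK-+ (u i) (u′ i))) (distribʳ _ _ _))) ⟩
      lincomb n (λ i → u i ℤ.+ u′ i) v            ∎)

    span-scale : ∀ {e} a → Span v n e → Span v n (intK a * e)
    span-scale {e} a (span u e≈) = span (λ i → a ℤ.* u i) (begin
      intK a * e                                  ≈⟨ *-congˡ e≈ ⟩
      intK a * lincomb n u v                      ≈⟨ sym (sumK-*ˡ n _ _) ⟩
      sumK n (λ i → intK a * (intK (u i) * v i))
        ≈⟨ sumK-cong n (λ i _ → sym (trans (*-congʳ (intK-* a (u i))) (*-assoc _ _ _))) ⟩
      lincomb n (λ i → a ℤ.* u i) v               ∎)

    span-neg : ∀ {e} → Span v n e → Span v n (- e)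
    span-neg x = span-resp (trans (*-congʳ (intK-neg (+ 1))) (trans (*-congʳ (-‿cong intK-1)) (-1*x≈-x _)))
                           (span-scale (ℤ.- (+ 1)) x)

    span-sumK : ∀ m (g : ℕ → Carrier) → (∀ i → i < m → Span v n (g i)) → Span v n (sumK m g)
    span-sumK zero    g g∈ = span-0
    span-sumK (suc m) g g∈ = span-+ (span-sumK m g (λ i i<m → g∈ i (ℕ.m<n⇒m<1+n i<m))) (g∈ m ℕ.≤-refl)

    span-basis : ∀ {j} → j < n → Span v n (v j)
    span-basis {j} j<n = span (δ j) (sym (begin
      lincomb n (δ j) v      ≈⟨ sumK-single n j _ j<n (λ i _ i≢j → trans (*-congʳ (intK-δ-other i≢j)) (zeroˡ _)) ⟩
      intK (δ j j) * v j     ≈⟨ *-congʳ (intK-δ-same j) ⟩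
      1# * v j               ≈⟨ *-identityˡ (v j) ⟩
      v j                    ∎))

  span-trans : ∀ {v w m n e} → (∀ k → k < m → Span w n (v k)) → Span v m e → Span w n e
  span-trans {v} {m = m} v∈ (span u e≈) =
    span-resp (sym e≈) (span-sumK m (λ i → intK (u i) * v i) (λ i i<m → span-scale (u i) (v∈ i i<m)))

  span-weaken : ∀ {v m n e} → m ≤ n → Span v m e → Span v n e
  span-weaken m≤n = span-trans (λ k k<m → span-basis (ℕ.<-≤-trans k<m m≤n))

  span-shift : ∀ {x m e} → Span (powK x) m e → Span (powK x) (suc m) (e * x)
  span-shift {x} {m} {e} (span u e≈) = span shifted (begin
    e * x                                       ≈⟨ *-congʳ e≈ ⟩
    lincomb m u (powK x) * x                    ≈⟨ sym (sumK-*ʳ m x _) ⟩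
    sumK m (λ i → intK (u i) * powK x i * x)    ≈⟨ sumK-cong m (λ i _ → *-assoc _ _ _) ⟩
    sumK m (λ i → intK (u i) * powK x (suc i))
      ≈⟨ sym (trans (sumK-head m _) (trans (+-congʳ (zeroˡ 1#)) (+-identityˡ _))) ⟩
    lincomb (suc m) shifted (powK x)            ∎)
    where
    shifted : ℕ → ℤ
    shifted zero    = + 0
    shifted (suc i) = u i

  Stable : (ℕ → Carrier) → ℕ → Carrier → Set (c ⊔ ℓ)
  Stable v n z = ∀ j → j < n → Span v n (z * v j)

  span-mul : ∀ {v n z e} → Stable v n z → Span v n e → Span v n (z * e)
  span-mul {v} {n} {z} {e} z-stable (span u e≈) =
    span-resp z·lincomb (span-sumK n _ (λ i i<n → span-scale (u i) (z-stable i i<n)))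
    where
    z·lincomb : sumK n (λ i → intK (u i) * (z * v i)) ≈ z * e
    z·lincomb = begin
      sumK n (λ i → intK (u i) * (z * v i))
        ≈⟨ sumK-cong n (λ i _ → solve 3 (λ a z x → a :* (z :* x) := z :* (a :* x)) refl _ _ _) ⟩
      sumK n (λ i → z * (intK (u i) * v i))      ≈⟨ sumK-*ˡ n z _ ⟩
      z * lincomb n u v                          ≈⟨ *-congˡ (sym e≈) ⟩
      z * e                                      ∎

  stable-pow : ∀ {v n z} → Stable v n z → ∀ i → Stable v n (powK z i)
  stable-pow z-stable zero    j j<n = span-resp (sym (*-identityˡ _)) (span-basis j<n)
  stable-pow z-stable (suc i) j j<n =
    span-resp (sym (*-assoc _ _ _)) (span-mul (stable-pow z-stable i) (z-stable j j<n))

  module Integrality (z : Carrier) where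

    -- Poly≤ d e / Monic d e: e is the value at z of an integer polynomial of degree
    -- at most d / of a monic one of degree d, witnessed by its Horner scheme.
    data Poly≤ : ℕ → Carrier → Set (c ⊔ ℓ) where
      const : ∀ {d e} a → e ≈ intK a → Poly≤ d e
      step  : ∀ {d e} e′ a → Poly≤ d e′ → e ≈ e′ * z + intK a → Poly≤ (suc d) e

    data Monic : ℕ → Carrier → Set (c ⊔ ℓ) where
      one  : ∀ {e} → e ≈ 1# → Monic 0 e
      step : ∀ {d e} e′ a → Monic d e′ → e ≈ e′ * z + intK a → Monic (suc d) e

    poly-resp : ∀ {d e e′} → e ≈ e′ → Poly≤ d e → Poly≤ d e′
    poly-resp e≈e′ (const a e≈)      = const a (trans (sym e≈e′) e≈)
    poly-resp e≈e′ (step e″ a p e≈)  = step e″ a p (trans (sym e≈e′) e≈)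

    monic-resp : ∀ {d e e′} → e ≈ e′ → Monic d e → Monic d e′
    monic-resp e≈e′ (one e≈)          = one (trans (sym e≈e′) e≈)
    monic-resp e≈e′ (step e″ a p e≈)  = step e″ a p (trans (sym e≈e′) e≈)

    poly-suc : ∀ {d e} → Poly≤ d e → Poly≤ (suc d) e
    poly-suc (const a e≈)     = const a e≈
    poly-suc (step e′ a p e≈) = step e′ a (poly-suc p) e≈

    poly-weaken : ∀ k {d e} → Poly≤ d e → Poly≤ (k ℕ.+ d) e
    poly-weaken zero    p = p
    poly-weaken (suc k) p = poly-suc (poly-weaken k p)

    poly-+ : ∀ {d e e′} → Poly≤ d e → Poly≤ d e′ → Poly≤ d (e + e′)
    poly-+ (const a e≈) (const b e′≈) =
      const (a ℤ.+ b) (trans (+-cong e≈ e′≈) (sym (intK-+ a b)))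
    poly-+ (const a e≈) (step q b p e′≈) = step q (a ℤ.+ b) p (begin
      _ + _                        ≈⟨ +-cong e≈ e′≈ ⟩
      intK a + (q * z + intK b)    ≈⟨ solve 3 (λ a x b → a :+ (x :+ b) := x :+ (a :+ b)) refl _ _ _ ⟩
      q * z + (intK a + intK b)    ≈⟨ +-congˡ (sym (intK-+ a b)) ⟩
      q * z + intK (a ℤ.+ b)       ∎)
    poly-+ (step q a p e≈) (const b e′≈) = step q (a ℤ.+ b) p (begin
      _ + _                        ≈⟨ +-cong e≈ e′≈ ⟩
      (q * z + intK a) + intK b    ≈⟨ +-assoc _ _ _ ⟩
      q * z + (intK a + intK b)    ≈⟨ +-congˡ (sym (intK-+ a b)) ⟩
      q * z + intK (a ℤ.+ b)       ∎)
    poly-+ (step q a p e≈) (step q′ b p′ e′≈) = step (q + q′) (a ℤ.+ b) (poly-+ p p′) (begin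
      _ + _                                   ≈⟨ +-cong e≈ e′≈ ⟩
      (q * z + intK a) + (q′ * z + intK b)
        ≈⟨ solve 5 (λ q a q′ b z → (q :* z :+ a) :+ (q′ :* z :+ b) := (q :+ q′) :* z :+ (a :+ b)) refl _ _ _ _ _ ⟩
      (q + q′) * z + (intK a + intK b)        ≈⟨ +-congˡ (sym (intK-+ a b)) ⟩
      (q + q′) * z + intK (a ℤ.+ b)           ∎)

    poly-scale : ∀ {d e} a → Poly≤ d e → Poly≤ d (intK a * e)
    poly-scale a (const b e≈)     = const (a ℤ.* b) (trans (*-congˡ e≈) (sym (intK-* a b)))
    poly-scale a (step q b p e≈)  = step (intK a * q) (a ℤ.* b) (poly-scale a p) (begin
      intK a * _                   ≈⟨ *-congˡ e≈ ⟩
      intK a * (q * z + intK b)    ≈⟨ solve 4 (λ a q z b → a :* (q :* z :+ b) := a :* q :* z :+ a :* b) refl _ _ _ _ ⟩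
      intK a * q * z + intK a * intK b ≈⟨ +-congˡ (sym (intK-* a b)) ⟩
      intK a * q * z + intK (a ℤ.* b)  ∎)

    poly-neg : ∀ {d e} → Poly≤ d e → Poly≤ d (- e)
    poly-neg p = poly-resp (trans (*-congʳ (trans (intK-neg (+ 1)) (-‿cong intK-1))) (-1*x≈-x _))
                           (poly-scale (ℤ.- (+ 1)) p)

    poly-*z : ∀ {d e} → Poly≤ d e → Poly≤ (suc d) (e * z)
    poly-*z {e = e} p = step e (+ 0) p (sym (+-identityʳ _))

    poly-* : ∀ {d d′ e e′} → Poly≤ d e → Poly≤ d′ e′ → Poly≤ (d ℕ.+ d′) (e * e′)
    poly-* {d} (const a e≈) p′ = poly-resp (*-congʳ (sym e≈)) (poly-weaken d (poly-scale a p′))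
    poly-* {suc d} {e′ = e′} (step q a p e≈) p′ =
      poly-resp (sym (trans (*-congʳ e≈) (solve 4 (λ q z a x → (q :* z :+ a) :* x := q :* x :* z :+ a :* x) refl _ _ _ _)))
        (poly-+ (poly-*z (poly-* p p′)) (poly-weaken (suc d) (poly-scale a p′)))

    monic⇒poly : ∀ {d e} → Monic d e → Poly≤ d e
    monic⇒poly (one e≈)          = const (+ 1) (trans e≈ (sym intK-1))
    monic⇒poly (step e′ a p e≈)  = step e′ a (monic⇒poly p) e≈

    monic-*z : ∀ {d e} → Monic d e → Monic (suc d) (e * z)
    monic-*z {e = e} p = step e (+ 0) p (sym (+-identityʳ _))

    monic-+ : ∀ {d e e′} → Monic (suc d) e → Poly≤ d e′ → Monic (suc d) (e + e′)
    monic-+ (step q a p e≈) (const b e′≈) = step q (a ℤ.+ b) p (begin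
      _ + _                        ≈⟨ +-cong e≈ e′≈ ⟩
      (q * z + intK a) + intK b    ≈⟨ +-assoc _ _ _ ⟩
      q * z + (intK a + intK b)    ≈⟨ +-congˡ (sym (intK-+ a b)) ⟩
      q * z + intK (a ℤ.+ b)       ∎)
    monic-+ {suc d} (step q a p e≈) (step q′ b p′ e′≈) = step (q + q′) (a ℤ.+ b) (monic-+ p p′) (begin
      _ + _                                   ≈⟨ +-cong e≈ e′≈ ⟩
      (q * z + intK a) + (q′ * z + intK b)
        ≈⟨ solve 5 (λ q a q′ b z → (q :* z :+ a) :+ (q′ :* z :+ b) := (q :+ q′) :* z :+ (a :+ b)) refl _ _ _ _ _ ⟩
      (q + q′) * z + (intK a + intK b)        ≈⟨ +-congˡ (sym (intK-+ a b)) ⟩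
      (q + q′) * z + intK (a ℤ.+ b)           ∎)

    monic-* : ∀ {d d′ e e′} → Monic d e → Monic d′ e′ → Monic (d ℕ.+ d′) (e * e′)
    monic-* (one e≈) p′ = monic-resp (sym (trans (*-congʳ e≈) (*-identityˡ _))) p′
    monic-* {suc d} (step q a p e≈) p′ =
      monic-resp (sym (trans (*-congʳ e≈) (solve 4 (λ q z a x → (q :* z :+ a) :* x := q :* x :* z :+ a :* x) refl _ _ _ _)))
        (monic-+ (monic-*z (monic-* p p′)) (poly-weaken d (poly-scale a (monic⇒poly p′))))

    monic-expansion : ∀ {d e} → Monic d e → Σ Carrier λ r → Span (powK z) d r × e ≈ r + powK z d
    monic-expansion (one e≈) = 0# , span-0 , trans e≈ (sym (+-identityˡ 1#))
    monic-expansion {suc d} (step e′ a p e≈) with monic-expansion p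
    ... | r , r∈ , e′≈ = r * z + intK a , span-+ (span-shift r∈) a∈ , (begin
      _                                   ≈⟨ e≈ ⟩
      e′ * z + intK a                     ≈⟨ +-congʳ (*-congʳ e′≈) ⟩
      (r + powK z d) * z + intK a
        ≈⟨ solve 4 (λ r p z a → (r :+ p) :* z :+ a := (r :* z :+ a) :+ p :* z) refl _ _ _ _ ⟩
      (r * z + intK a) + powK z (suc d)   ∎)
      where
      a∈ : Span (powK z) (suc d) (intK a)
      a∈ = span-resp (*-identityʳ _) (span-scale a (span-basis (s≤s z≤n)))

    monic-root⇒integral : ∀ {d e} → Monic d e → e ≈ 0# → IsAlgebraicInteger z
    monic-root⇒integral {d} p e≈0 with monic-expansion p
    ... | r , span u r≈ , e≈ = d , u , trans (+-congʳ (sym r≈)) (trans (sym e≈) e≈0)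

    record System (w : ℕ → Carrier) (m e : ℕ) : Set (c ⊔ ℓ) where
      field
        entry        : ℕ → ℕ → Carrier
        annihilates  : ∀ j → j < suc m → sumK (suc m) (λ k → entry j k * w k) ≈ 0#
        diagonal     : ∀ j → j < suc m → Monic (suc e) (entry j j)
        off-diagonal : ∀ j k → j < suc m → k < suc m → j ≢ k → Poly≤ e (entry j k)

    -- Fraction-free elimination of the last unknown: row j becomes B_pp·(row j) − B_jp·(row p).
    eliminate-last : ∀ {w m e} → System w (suc m) e → System w m (suc (e ℕ.+ e))
    eliminate-last {w} {m} {e} S = record
      { entry        = entry′
      ; annihilates  = annihilates′
      ; diagonal     = diagonal′
      ; off-diagonal = off-diagonal′
      }
      where
      open System S
      p = suc m
      p<  : p < suc p
      p<  = ℕ.≤-refl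
      <p  : ∀ {j} → j < suc m → j < suc p
      <p  = ℕ.m<n⇒m<1+n
      ≢p  : ∀ {j} → j < suc m → j ≢ p
      ≢p  j<p = ℕ.<⇒≢ j<p
      p≢  : ∀ {j} → j < suc m → p ≢ j
      p≢  j<p = ℕ.<⇒≢ j<p ∘ ≡.sym

      entry′ : ℕ → ℕ → Carrier
      entry′ j k = entry p p * entry j k - entry j p * entry p k

      annihilates′ : ∀ j → j < suc m → sumK p (λ k → entry′ j k * w k) ≈ 0#
      annihilates′ j j<p = begin
        sumK p (λ k → entry′ j k * w k)
          ≈⟨ sumK-cong p (λ k _ → solve 5 (λ a b c d x → (a :* b :- c :* d) :* x := a :* (b :* x) :- c :* (d :* x)) refl _ _ _ _ _) ⟩
        sumK p (λ k → entry p p * (entry j k * w k) - entry j p * (entry p k * w k))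
          ≈⟨ trans (sumK-+ p _ _) (+-cong (sumK-*ˡ p _ _) (trans (sumK-neg p _) (-‿cong (sumK-*ˡ p _ _)))) ⟩
        entry p p * Σj - entry j p * Σp
          ≈⟨ solve 5 (λ a s b t x → a :* s :- b :* t := a :* (s :+ b :* x) :- b :* (t :+ a :* x)) refl _ _ _ _ (w p) ⟩
        entry p p * (Σj + entry j p * w p) - entry j p * (Σp + entry p p * w p)
          ≈⟨ +-cong (*-congˡ (annihilates j (<p j<p))) (-‿cong (*-congˡ (annihilates p p<))) ⟩
        entry p p * 0# - entry j p * 0#
          ≈⟨ solve 2 (λ a b → a :* con (+ 0) :- b :* con (+ 0) := con (+ 0)) refl _ _ ⟩
        0#  ∎
        where
        Σj = sumK p (λ k → entry j k * w k)
        Σp = sumK p (λ k → entry p k * w k)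

      e+1+e≡1+e+e : e ℕ.+ suc e ≡ suc (e ℕ.+ e)
      e+1+e≡1+e+e = ℕ.+-suc e e

      diagonal′ : ∀ j → j < suc m → Monic (suc (suc (e ℕ.+ e))) (entry′ j j)
      diagonal′ j j<p = ≡.subst (λ d → Monic (suc d) (entry′ j j)) e+1+e≡1+e+e
        (monic-+ (monic-* (diagonal p p<) (diagonal j (<p j<p)))
          (≡.subst (λ d → Poly≤ d (- (entry j p * entry p j))) (≡.sym e+1+e≡1+e+e)
            (poly-suc (poly-neg (poly-* (off-diagonal j p (<p j<p) p< (≢p j<p))
                                        (off-diagonal p j p< (<p j<p) (p≢ j<p)))))))

      off-diagonal′ : ∀ j k → j < suc m → k < suc m → j ≢ k → Poly≤ (suc (e ℕ.+ e)) (entry′ j k)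
      off-diagonal′ j k j<p k<p j≢k =
        poly-+ (poly-* (monic⇒poly (diagonal p p<)) (off-diagonal j k (<p j<p) (<p k<p) j≢k))
               (poly-suc (poly-neg (poly-* (off-diagonal j p (<p j<p) p< (≢p j<p))
                                           (off-diagonal p k p< (<p k<p) (p≢ k<p)))))

    system⇒integral : ∀ {w m e} → w 0 ≈ 1# → System w m e → IsAlgebraicInteger z
    system⇒integral {m = zero} w0≈1 S = monic-root⇒integral (diagonal 0 (s≤s z≤n))
      (trans (sym (trans (+-identityˡ _) (trans (*-congˡ w0≈1) (*-identityʳ _)))) (annihilates 0 (s≤s z≤n)))
      where open System S
    system⇒integral {m = suc m} w0≈1 S = system⇒integral w0≈1 (eliminate-last S)

  stable⇒integral : ∀ {v n z} → 0 < n → v 0 ≈ 1# → Stable v n z → IsAlgebraicInteger z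
  stable⇒integral {v} {suc m} {z} _ v0≈1 z-stable = system⇒integral v0≈1 (record
    { entry        = entry
    ; annihilates  = annihilates
    ; diagonal     = λ j _ → step 1# (ℤ.- M j j) (one refl) (+-cong (*-congʳ (intK-δ-same j)) (sym (intK-neg (M j j))))
    ; off-diagonal = λ j k _ _ j≢k → const (ℤ.- M j k)
        (trans (+-congʳ (trans (*-congʳ (intK-δ-other (j≢k ∘ ≡.sym))) (zeroˡ z)))
               (trans (+-identityˡ _) (sym (intK-neg (M j k)))))
    })
    where
    open Integrality z
    n = suc m

    M : ℕ → ℕ → ℤ
    M j with j ℕ.<? n
    ... | yes j<n = Span.coeff (z-stable j j<n)
    ... | no  _   = λ _ → + 0

    z·v-expansion : ∀ j → j < n → z * v j ≈ lincomb n (M j) v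
    z·v-expansion j j<n with j ℕ.<? n
    ... | yes j<n′ = Span.expansion (z-stable j j<n′)
    ... | no  j≮n  = ⊥-elim (j≮n j<n)

    entry : ℕ → ℕ → Carrier
    entry j k = intK (δ j k) * z - intK (M j k)

    annihilates : ∀ j → j < n → sumK n (λ k → entry j k * v k) ≈ 0#
    annihilates j j<n = begin
      sumK n (λ k → entry j k * v k)
        ≈⟨ sumK-cong n (λ k _ → solve 4 (λ d z a x → (d :* z :- a) :* x := d :* (z :* x) :- a :* x) refl _ _ _ _) ⟩
      sumK n (λ k → intK (δ j k) * (z * v k) - intK (M j k) * v k)
        ≈⟨ trans (sumK-+ n _ _) (+-congˡ (sumK-neg n _)) ⟩
      sumK n (λ k → intK (δ j k) * (z * v k)) - lincomb n (M j) v
        ≈⟨ +-cong (sumK-single n j _ j<n (λ k _ k≢j → trans (*-congʳ (intK-δ-other k≢j)) (zeroˡ _)))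
                  (-‿cong (sym (z·v-expansion j j<n))) ⟩
      intK (δ j j) * (z * v j) - z * v j
        ≈⟨ +-congʳ (trans (*-congʳ (intK-δ-same j)) (*-identityˡ _)) ⟩
      z * v j - z * v j                         ≈⟨ -‿inverseʳ _ ⟩
      0#                                        ∎

  Leading : ℤ → (ℕ → Carrier) → ℕ → Carrier → Set (c ⊔ ℓ)
  Leading s w m x = Σ Carrier λ r → Span w m r × x ≈ intK s * w m + r

  leading⇒span : ∀ {s w m x} → Leading s w m x → Span w (suc m) x
  leading⇒span {s} (r , r∈ , x≈) =
    span-resp (sym x≈) (span-+ (span-scale s (span-basis ℕ.≤-refl)) (span-weaken (ℕ.n≤1+n _) r∈))

  affine-powers : ∀ {x y} a e → x ≈ intK a + intK e * y → ∀ m → Leading (e ℤ.^ m) (powK y) m (powK x m)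
  affine-powers a e x≈ zero = 0# , span-0 , sym (trans (+-identityʳ _) (trans (*-congʳ intK-1) (*-identityˡ 1#)))
  affine-powers {x} {y} a e x≈ (suc m) with affine-powers a e x≈ m
  ... | r , r∈ , xᵐ≈ = r′ , r′∈ , (begin
    powK x m * x                               ≈⟨ *-cong xᵐ≈ x≈ ⟩
    (S * Y + r) * (A + E * y)
      ≈⟨ solve 6 (λ S Y r A E y → (S :* Y :+ r) :* (A :+ E :* y) := E :* S :* (Y :* y) :+ (S :* A :* Y :+ (A :* r :+ E :* (r :* y)))) refl _ _ _ _ _ _ ⟩
    E * S * (Y * y) + r′                       ≈⟨ +-congʳ (*-congʳ (sym (intK-* e (e ℤ.^ m)))) ⟩
    intK (e ℤ.^ suc m) * powK y (suc m) + r′   ∎)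
    where
    S = intK (e ℤ.^ m)
    A = intK a
    E = intK e
    Y = powK y m
    r′ = S * A * Y + (A * r + E * (r * y))
    r′∈ : Span (powK y) (suc m) r′
    r′∈ = span-+ (span-resp (*-congʳ (intK-* (e ℤ.^ m) a)) (span-scale (e ℤ.^ m ℤ.* a) (span-basis ℕ.≤-refl)))
                 (span-+ (span-scale a (span-weaken (ℕ.n≤1+n m) r∈)) (span-scale e (span-shift r∈)))

  unitriangular-independent : ∀ {v w n} (s : ℕ → ℤ) → Independent w n →
    (∀ m → m < n → IsUnitℤ (s m) × Leading (s m) w m (v m)) → Independent v n
  unitriangular-independent {v} {w} {n} s w-independent triangular = prefix n ℕ.≤-refl
    where
    prefix : ∀ m → m ≤ n → Independent v m
    prefix zero    _   u _ i ()
    prefix (suc m) m<n u u·v≈0 with triangular m m<n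
    ... | sₘ-unit , r , r∈ , vₘ≈ = coefficients-vanish
      where
      S = lincomb m u v
      S∈ : Span w m S
      S∈ = span-sumK m _ (λ i i<m →
        span-scale (u i) (span-weaken i<m (leading⇒span {s i} (proj₂ (triangular i (ℕ.<-trans i<m m<n))))))
      S+uₘr∈ : Span w m (S + intK (u m) * r)
      S+uₘr∈ = span-+ S∈ (span-scale (u m) r∈)
      coeffs = Span.coeff S+uₘr∈
      t = u m ℤ.* s m

      w-relation : lincomb (suc m) (pad m coeffs t) w ≈ 0#
      w-relation = begin
        lincomb (suc m) (pad m coeffs t) w                         ≈⟨ lincomb-pad-last m coeffs t w ⟩
        lincomb m coeffs w + intK t * w m                          ≈⟨ +-cong (sym (Span.expansion S+uₘr∈)) (*-congʳ (intK-* (u m) (s m))) ⟩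
        (S + intK (u m) * r) + intK (u m) * intK (s m) * w m
          ≈⟨ solve 5 (λ S a r b x → (S :+ a :* r) :+ a :* b :* x := S :+ a :* (b :* x :+ r)) refl _ _ _ _ _ ⟩
        S + intK (u m) * (intK (s m) * w m + r)               ≈⟨ +-congˡ (*-congˡ (sym vₘ≈)) ⟩
        S + intK (u m) * v m                                  ≈⟨ u·v≈0 ⟩
        0#                                                    ∎

      uₘ≡0 : u m ≡ + 0
      uₘ≡0 = *-unit-cancel (u m) sₘ-unit (≡.trans (≡.sym (pad-≥ {m} coeffs t ℕ.≤-refl))
        (independent-prefix w-independent m<n (pad m coeffs t) w-relation m ℕ.≤-refl))

      S≈0 : S ≈ 0#
      S≈0 = trans (sym (trans (+-congˡ (trans (*-congʳ (reflexive (≡.cong intK uₘ≡0))) (zeroˡ _))) (+-identityʳ S))) u·v≈0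

      coefficients-vanish : ∀ i → i < suc m → u i ≡ + 0
      coefficients-vanish i i<1+m with i ℕ.≟ m
      ... | yes ≡.refl = uₘ≡0
      ... | no  i≢m    = prefix m (ℕ.<⇒≤ m<n) u S≈0 i (ℕ.≤∧≢⇒< (ℕ.≤-pred i<1+m) i≢m)

  pow-cancel : ∀ {x y} → x * y ≈ 1# → ∀ i r → powK x i * powK y (i ℕ.+ r) ≈ powK y r
  pow-cancel         xy≈1 zero    r = *-identityˡ _
  pow-cancel {x} {y} xy≈1 (suc i) r = begin
    powK x i * x * (powK y (i ℕ.+ r) * y)   ≈⟨ solve 4 (λ p x q y → p :* x :* (q :* y) := p :* q :* (x :* y)) refl _ _ _ _ ⟩
    powK x i * powK y (i ℕ.+ r) * (x * y)   ≈⟨ *-cong (pow-cancel xy≈1 i r) xy≈1 ⟩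
    powK y r * 1#                           ≈⟨ *-identityʳ _ ⟩
    powK y r                                ∎

  pow-cancel-≤ : ∀ {x y} → x * y ≈ 1# → ∀ {i k} → i ≤ k → powK x i * powK y k ≈ powK y (k ℕ.∸ i)
  pow-cancel-≤ {x} {y} xy≈1 {i} {k} i≤k =
    ≡.subst (λ l → powK x i * powK y l ≈ powK y (k ℕ.∸ i)) (ℕ.m+[n∸m]≡n i≤k) (pow-cancel xy≈1 i (k ℕ.∸ i))

  -- Multiplying by a^k turns Σ u_j b^j into Σ u_j a^(k-j), the same relation read backwards.
  reciprocal-independent : ∀ {a b k} → a * b ≈ 1# → Independent (powK a) (suc k) → Independent (powK b) (suc k)
  reciprocal-independent {a} {b} {k} ab≈1 a-independent u u·b≈0 j (s≤s j≤k) =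
    ≡.trans (≡.cong u (≡.sym (ℕ.m∸[m∸n]≡n j≤k)))
            (a-independent (λ i → u (k ℕ.∸ i)) reversed≈0 (k ℕ.∸ j) (s≤s (ℕ.m∸n≤m k j)))
    where
    ba≈1 = trans (*-comm b a) ab≈1
    f : ℕ → Carrier
    f i = intK (u i) * powK a (k ℕ.∸ i)
    reversed≈0 : lincomb (suc k) (λ i → u (k ℕ.∸ i)) (powK a) ≈ 0#
    reversed≈0 = begin
      lincomb (suc k) (λ i → u (k ℕ.∸ i)) (powK a)
        ≈⟨ sumK-cong (suc k) (λ i i<1+k → *-congˡ (reflexive (≡.cong (powK a) (≡.sym (ℕ.m∸[m∸n]≡n (ℕ.≤-pred i<1+k)))))) ⟩
      sumK (suc k) (λ i → f (k ℕ.∸ i))           ≈⟨ sym (sumK-reverse (suc k) f) ⟩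
      sumK (suc k) f
        ≈⟨ sumK-cong (suc k) (λ i i<1+k → *-congˡ (sym (trans (*-comm _ _) (pow-cancel-≤ ba≈1 (ℕ.≤-pred i<1+k))))) ⟩
      sumK (suc k) (λ i → intK (u i) * (powK a k * powK b i))
        ≈⟨ sumK-cong (suc k) (λ i _ → solve 3 (λ c p q → c :* (p :* q) := p :* (c :* q)) refl _ _ _) ⟩
      sumK (suc k) (λ i → powK a k * (intK (u i) * powK b i)) ≈⟨ sumK-*ˡ (suc k) _ _ ⟩
      powK a k * lincomb (suc k) u (powK b)     ≈⟨ *-congˡ u·b≈0 ⟩
      powK a k * 0#                             ≈⟨ zeroʳ _ ⟩
      0#                                        ∎

  -- a = a^(k+1) b^k, and a^(k+1) is a combination of a^i b^k = b^(k-i).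
  reciprocal-spans : ∀ {a b k} → a * b ≈ 1# → Span (powK a) (suc k) (powK a (suc k)) →
    ∀ i → Span (powK b) (suc k) (powK a i)
  reciprocal-spans {a} {b} {k} ab≈1 (span u aᵏ⁺¹≈) = powers
    where
    a≈ : a ≈ sumK (suc k) (λ i → intK (u i) * (powK a i * powK b k))
    a≈ = begin
      a                                  ≈⟨ sym (trans (*-congˡ (pow-cancel-≤ ab≈1 {k} ℕ.≤-refl)) (trans (*-congˡ (reflexive (≡.cong (powK b) (ℕ.n∸n≡0 k)))) (*-identityʳ a))) ⟩
      a * (powK a k * powK b k)          ≈⟨ solve 3 (λ a p q → a :* (p :* q) := p :* a :* q) refl _ _ _ ⟩
      powK a (suc k) * powK b k          ≈⟨ *-congʳ aᵏ⁺¹≈ ⟩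
      lincomb (suc k) u (powK a) * powK b k  ≈⟨ sym (sumK-*ʳ (suc k) _ _) ⟩
      sumK (suc k) (λ i → intK (u i) * powK a i * powK b k)  ≈⟨ sumK-cong (suc k) (λ i _ → *-assoc _ _ _) ⟩
      sumK (suc k) (λ i → intK (u i) * (powK a i * powK b k)) ∎

    a∈ : Span (powK b) (suc k) a
    a∈ = span-resp (sym a≈) (span-sumK (suc k) _ (λ i i<1+k →
      span-scale (u i) (span-resp (sym (pow-cancel-≤ ab≈1 (ℕ.≤-pred i<1+k))) (span-basis (s≤s (ℕ.m∸n≤m k i))))))

    a-stable : Stable (powK b) (suc k) a
    a-stable zero    _     = span-resp (sym (*-identityʳ a)) a∈
    a-stable (suc j) j+1<n = span-resp
      (sym (trans (solve 3 (λ a p b → a :* (p :* b) := p :* (a :* b)) refl _ _ _) (trans (*-congˡ ab≈1) (*-identityʳ _))))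
      (span-basis (ℕ.<-trans (ℕ.n<1+n j) j+1<n))

    powers : ∀ i → Span (powK b) (suc k) (powK a i)
    powers zero    = span-basis (s≤s z≤n)
    powers (suc i) = span-resp (*-comm a _) (span-mul a-stable (powers i))

  independent-quadratic : ∀ {x n} → Independent (powK x) n → 2 < n →
    ∀ a b c → intK a + intK b * x + intK c * (x * x) ≈ 0# → c ≡ + 0
  independent-quadratic {x} {n} x-independent 2<n a b c relation =
    x-independent u u·x≈0 2 2<n
    where
    u : ℕ → ℤ
    u 0 = a
    u 1 = b
    u 2 = c
    u _ = + 0
    u·x≈0 : lincomb n u (powK x) ≈ 0#
    u·x≈0 = begin
      lincomb n u (powK x)                                       ≈⟨ sumK-vanishing-tail _ 2<n vanishes ⟩
      (0# + intK a * 1#) + intK b * (1# * x) + intK c * (1# * x * x)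
        ≈⟨ solve 4 (λ a b c x → (con (+ 0) :+ a :* con (+ 1)) :+ b :* (con (+ 1) :* x) :+ c :* (con (+ 1) :* x :* x)
                              := a :+ b :* x :+ c :* (x :* x)) refl _ _ _ _ ⟩
      intK a + intK b * x + intK c * (x * x)                     ≈⟨ relation ⟩
      0#                                                         ∎
      where
      vanishes : ∀ i → 3 ≤ i → intK (u i) * powK x i ≈ 0#
      vanishes (suc (suc (suc i))) _ = zeroˡ _
      vanishes 1 (s≤s ())
      vanishes 2 (s≤s (s≤s ()))

  module TheElement
    (n₁ : ℕ) (f : ℕ → ℤ) (f-monic : f (suc n₁) ≡ + 1) (f₀-unit : IsUnitℤ (f 0))
    (α : Carrier) (α-root : evalK f (suc n₁) α ≈ 0#)
    (α-independent : Independent (powK α) (suc n₁))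
    where

    n = suc n₁
    β = theElement f n α
    ε = ℤ.- f 0
    E = intK ε
    A₁ = intK (f 1)
    y = E * (β + A₁)

    ε-unit : IsUnitℤ ε
    ε-unit = unit-neg f₀-unit

    E·E≈1 : E * E ≈ 1#
    E·E≈1 = trans (sym (intK-* ε ε)) (trans (reflexive (≡.cong intK (unit-square ε-unit))) intK-1)

    β·α≈ : β * α ≈ E - A₁ * α
    β·α≈ = begin
      β * α
        ≈⟨ solve 4 (λ a b x t → t := (a :* con (+ 1) :+ (b :* (con (+ 1) :* x) :+ t)) :- a :- b :* x) refl _ _ _ _ ⟩
      evaluation - intK (f 0) - A₁ * α    ≈⟨ +-congʳ (+-congʳ evaluation≈0) ⟩
      0# - intK (f 0) - A₁ * α            ≈⟨ +-congʳ (trans (+-identityˡ _) (sym (intK-neg (f 0)))) ⟩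
      E - A₁ * α                          ∎
      where
      evaluation = intK (f 0) * 1# + (A₁ * (1# * α) + β * α)
      tail≈β·α : sumK n₁ (λ i → intK (f (2 ℕ.+ i)) * powK α (2 ℕ.+ i)) ≈ β * α
      tail≈β·α = trans (sumK-cong n₁ (λ i _ → sym (*-assoc _ _ _))) (sumK-*ʳ n₁ α _)
      evaluation≈0 : evaluation ≈ 0#
      evaluation≈0 = trans (sym (trans (sumK-head n _) (+-congˡ (trans (sumK-head n₁ _) (+-congˡ tail≈β·α))))) α-root

    α·y≈1 : α * y ≈ 1#
    α·y≈1 = begin
      α * (E * (β + A₁))                    ≈⟨ solve 4 (λ x e b a → x :* (e :* (b :+ a)) := e :* (e :+ (b :* x :- (e :- a :* x)))) refl _ _ _ _ ⟩
      E * (E + (β * α - (E - A₁ * α)))      ≈⟨ *-congˡ (+-congˡ (x≈y⇒x∙y⁻¹≈ε β·α≈)) ⟩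
      E * (E + 0#)                          ≈⟨ *-congˡ (+-identityʳ E) ⟩
      E * E                                 ≈⟨ E·E≈1 ⟩
      1#                                    ∎

    β≈ : β ≈ intK (ℤ.- f 1) + E * y
    β≈ = sym (begin
      intK (ℤ.- f 1) + E * (E * (β + A₁))   ≈⟨ +-cong (intK-neg (f 1)) (sym (*-assoc _ _ _)) ⟩
      - A₁ + E * E * (β + A₁)               ≈⟨ +-congˡ (*-congʳ E·E≈1) ⟩
      - A₁ + 1# * (β + A₁)                  ≈⟨ solve 2 (λ a b → :- a :+ con (+ 1) :* (b :+ a) := b) refl _ _ ⟩
      β                                     ∎)

    y≈ : y ≈ intK (ε ℤ.* f 1) + E * β
    y≈ = trans (trans (*-comm E _) (trans (distribʳ E β A₁) (+-comm _ _)))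
               (+-cong (trans (*-comm A₁ E) (sym (intK-* ε (f 1)))) (*-comm β E))

    β+sα∈ℤ⇒s≡0 : 2 < n → ∀ s m → β + intK s * α ≈ intK m → s ≡ + 0
    β+sα∈ℤ⇒s≡0 2<n s m β+sα≈m = independent-quadratic α-independent 2<n ε (ℤ.- (f 1 ℤ.+ m)) s (begin
      E + intK (ℤ.- (f 1 ℤ.+ m)) * α + S * (α * α)
        ≈⟨ +-congʳ (+-congˡ (*-congʳ (trans (intK-neg (f 1 ℤ.+ m)) (-‿cong (intK-+ (f 1) m))))) ⟩
      E + - (A₁ + M) * α + S * (α * α)
        ≈⟨ solve 6 (λ e a m s x b → e :+ :- (a :+ m) :* x :+ s :* (x :* x)
                                  := ((e :- a :* x) :- b :* x) :+ x :* ((b :+ s :* x) :- m)) refl _ _ _ _ _ _ ⟩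
      ((E - A₁ * α) - β * α) + α * ((β + S * α) - M)
        ≈⟨ +-cong (x≈y⇒x∙y⁻¹≈ε (sym β·α≈)) (*-congˡ (x≈y⇒x∙y⁻¹≈ε β+sα≈m)) ⟩
      0# + α * 0#                                    ≈⟨ trans (+-identityˡ _) (zeroʳ α) ⟩
      0#                                             ∎)
      where
      M = intK m
      S = intK s

    β-not-equivalent : 2 < n → ¬ Equivalent β α
    β-not-equivalent 2<n (inj₁ (m , β+α≈m)) = unit-≢0 (inj₁ ≡.refl)
      (β+sα∈ℤ⇒s≡0 2<n (+ 1) m (trans (+-congˡ (trans (*-congʳ intK-1) (*-identityˡ α))) β+α≈m))
    β-not-equivalent 2<n (inj₂ (m , β-α≈m)) = unit-≢0 (inj₂ ≡.refl)
      (β+sα∈ℤ⇒s≡0 2<n (ℤ.- (+ 1)) m (trans (+-congˡ (trans (*-congʳ (trans (intK-neg (+ 1)) (-‿cong intK-1))) (-1*x≈-x α))) β-α≈m))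

    β∈ : Span (powK α) n β
    β∈ = span-resp (trans (sym (sumK-*ʳ n₁ α _)) (sumK-cong n₁ (λ i _ → *-assoc _ _ _)))
                   (span-shift (span (λ i → f (2 ℕ.+ i)) refl))

    β-stable : Stable (powK α) n β
    β-stable zero    _     = span-resp (sym (*-identityʳ β)) β∈
    β-stable (suc j) j+1<n = span-resp (sym βαʲ⁺¹≈)
      (span-+ (span-scale ε (span-basis (ℕ.<-trans (ℕ.n<1+n j) j+1<n))) (span-scale (ℤ.- f 1) (span-basis j+1<n)))
      where
      βαʲ⁺¹≈ : β * (powK α j * α) ≈ E * powK α j + intK (ℤ.- f 1) * (powK α j * α)
      βαʲ⁺¹≈ = begin
        β * (powK α j * α)                         ≈⟨ solve 3 (λ b p x → b :* (p :* x) := p :* (b :* x)) refl _ _ _ ⟩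
        powK α j * (β * α)                         ≈⟨ *-congˡ β·α≈ ⟩
        powK α j * (E - A₁ * α)                    ≈⟨ solve 4 (λ p e a x → p :* (e :- a :* x) := e :* p :+ :- a :* (p :* x)) refl _ _ _ _ ⟩
        E * powK α j + - A₁ * (powK α j * α)       ≈⟨ +-congˡ (*-congʳ (sym (intK-neg (f 1)))) ⟩
        E * powK α j + intK (ℤ.- f 1) * (powK α j * α) ∎

    β-powers-integral : ∀ i → IsAlgebraicInteger (powK β i)
    β-powers-integral i = stable⇒integral (s≤s z≤n) refl (stable-pow β-stable i)

    αⁿ∈ : Span (powK α) n (powK α n)
    αⁿ∈ = span-resp (sym αⁿ≈) (span-neg (span f refl))
      where
      αⁿ≈ : powK α n ≈ - lincomb n f (powK α)
      αⁿ≈ = +-inverseʳ-unique _ _ (trans (+-congˡ (sym (trans (*-congʳ (trans (reflexive (≡.cong intK f-monic)) intK-1))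
                                                                  (*-identityˡ _))))
                                         α-root)

    y-independent : Independent (powK y) n
    y-independent = reciprocal-independent α·y≈1 α-independent

    β-independent : Independent (powK β) n
    β-independent = unitriangular-independent (ε ℤ.^_) y-independent
      (λ m _ → unit-^ ε-unit m , affine-powers (ℤ.- f 1) ε β≈ m)

    β-spans : ∀ {x} → Span (powK α) n x → Span (powK β) n x
    β-spans = span-trans yᵏ∈ ∘ span-trans (λ k _ → reciprocal-spans α·y≈1 αⁿ∈ k)
      where
      yᵏ∈ : ∀ k → k < n → Span (powK β) n (powK y k)
      yᵏ∈ k k<n = span-weaken k<n (leading⇒span {ε ℤ.^ k} (affine-powers (ε ℤ.* f 1) ε y≈ k))

    β-power-integral-basis : (∀ x → IsAlgebraicInteger x → ∃ λ u → x ≈ lincomb n u (powK α)) →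
      PowerIntegralBasis n β
    β-power-integral-basis α-spans =
        (λ i _ → β-powers-integral i)
      , (λ x x-integral → let span u x≈ = β-spans (uncurry span (α-spans x x-integral)) in u , x≈)
      , β-independent

open import Data.Integer using (-_)

mainTheorem2 : ∀ {c ℓ : Level} (K : CommutativeRing c ℓ) →
    let open InRing K in IsField → CharZero →
    (n : ℕ) → 2 < n →
    (f : ℕ → ℤ) → MonicOfDegree f n →
    (f 0 ≡ + 1 ⊎ f 0 ≡ - (+ 1)) →
    Irreducibleℤ[x] f →
    (α : Carrier) → evalK f n α ≈ 0# →
    GeneratedBy α →
    PowerIntegralBasis n α →
    ¬ Equivalent (theElement f n α) α × PowerIntegralBasis n (theElement f n α)
mainTheorem2 K _ _ (suc n₁) 2<n f (f-monic , _) f₀-unit _ α α-root _ (_ , α-spans , α-independent) =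
  β-not-equivalent 2<n , β-power-integral-basis α-spans
  where open CommutativeRingFacts.TheElement K n₁ f f-monic f₀-unit α α-root α-independent
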